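{- Let $E: y^2 = x^3 + a_4x + a_6$ with $a_4,a_6\in\mathbb{Z}$ be an elliptic curve over $\mathbb{Q}$, let $(u,v)\in\mathbb{Z}^2$ be map-suitable for $E$, and suppose $-D_E(u,v)$ is a negative fundamental discriminant. For $P\in E(\mathbb{Q})\setminus\{\mathcal{O}\}$ write $P = (A/C^2, B/C^3)$ with $A,B,C\in\mathbb{Z}$, $\gcd(A,C)=\gcd(B,C)=1$, $C>0$, and set $a := Av + C^2u$, $g := \gcd(C,v)$. For any integer $\mu$ with $\frac{C^3}{g^2}\mu\equiv 1\pmod{\frac{va}{g^2}}$ let $\Phi_{u,v}(P,\mu)$ be the form $\frac{va}{g^2}x^2 + 2\mu\frac{Bv^2}{g^2}xy + \frac{\mu^2 B^2v^4/g^4 + d_E(u,v)}{va/g^2}y^2$. Then: (1) The class of $\Phi_{u,v}(P,\mu)$ in $\mathrm{CL}(-D_E(u,v))$ depends only on $P$ and not on the choice of $\mu$; hence, setting $\Phi_{u,v}(\mathcal{O})$ to be the identity, this defines a map $\Phi_{u,v}: E(\mathbb{Q})\to\mathrm{CL}(-D_E(u,v))$. (2) If $P\neq\mathcal{O}$ and $\Phi_{u,v}(P)$ is the identity of $\mathrm{CL}(-D_E(u,v))$, then either $v\mid C$ or $\frac{va}{g^2}\ge d_E(u,v)$.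
   Context: Notation: $d_E(u,v) := v(u^3 + a_4uv^2 - a_6v^3)$ and $D_E(u,v) := 4d_E(u,v)$. A pair $(u,v)\in\mathbb{Z}^2$ is map-suitable for $E$ if $u$, $v$, $3u^2 + a_4v^2$ and $D_E(u,v)$ are all positive. Such $\mu$ always exist and $\Phi_{u,v}(P,\mu)$ is a positive definite integral form of discriminant $-D_E(u,v)$; $\mathrm{CL}(-D)$ is identified with the group of $\mathrm{SL}_2(\mathbb{Z})$-classes of primitive positive definite integral binary quadratic forms of discriminant $-D$. -}

module Defs where

open import Data.Nat using (ℕ)
import Data.Nat as ℕ
open import Data.Integer using (ℤ; +_; -[1+_]; _+_; _-_; _*_; -_; _<_; _≤_; ∣_∣; _/_)
open import Data.Integer.Divisibility using (_∣_)
open import Data.Integer.GCD using (gcd)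
open import Data.Product using (Σ; ∃; _×_; _,_)
open import Data.Sum using (_⊎_)
open import Relation.Binary.PropositionalEquality using (_≡_; _≢_)

-- Integer division (exact in all uses below); divisor 0 gives 0 by convention.
divℤ : ℤ → ℤ → ℤ
divℤ i (+ 0) = + 0
divℤ i (+ ℕ.suc n) = i / (+ ℕ.suc n)
divℤ i -[1+ n ] = i / -[1+ n ]

IsElliptic : ℤ → ℤ → Set
IsElliptic a4 a6 = (+ 4) * (a4 * a4 * a4) + (+ 27) * (a6 * a6) ≢ + 0

dE : ℤ → ℤ → ℤ → ℤ → ℤ
dE a4 a6 u v = v * (u * u * u + a4 * u * (v * v) - a6 * (v * v * v))

DE : ℤ → ℤ → ℤ → ℤ → ℤ
DE a4 a6 u v = (+ 4) * dE a4 a6 u v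

MapSuitable : ℤ → ℤ → ℤ → ℤ → Set
MapSuitable a4 a6 u v =
  (+ 0 < u) × (+ 0 < v) × (+ 0 < (+ 3) * (u * u) + a4 * (v * v)) × (+ 0 < DE a4 a6 u v)

-- square-free integer: no square n^2 with n ≠ 1 divides it (so 0 is not square-free)
SquareFree : ℤ → Set
SquareFree m = ∀ (n : ℕ) → (+ n) * (+ n) ∣ m → n ≡ 1

FundamentalDisc : ℤ → Set
FundamentalDisc Δ =
  ((∃ λ k → Δ ≡ (+ 4) * k + (+ 1)) × SquareFree Δ)
  ⊎ (∃ λ m → (Δ ≡ (+ 4) * m)
        × ((∃ λ k → m ≡ (+ 4) * k + (+ 2)) ⊎ (∃ λ k → m ≡ (+ 4) * k + (+ 3)))
        × SquareFree m)

-- P = (A/C^2, B/C^3) is an affine rational point of E in lowest terms with C > 0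
PointRep : ℤ → ℤ → ℤ → ℤ → ℤ → Set
PointRep a4 a6 A B C =
  (+ 0 < C) × (gcd A C ≡ + 1) × (gcd B C ≡ + 1)
  × (B * B ≡ A * A * A + a4 * A * (C * C * C * C) + a6 * (C * C * C * C * C * C))

-- binary quadratic form  a x^2 + b x y + c y^2
record Form : Set where
  constructor form
  field
    fa fb fc : ℤ

-- f(p x + q y, r x + s y)
act : Form → ℤ → ℤ → ℤ → ℤ → Form
act (form a b c) p q r s =
  form (a * (p * p) + b * (p * r) + c * (r * r))
       ((+ 2) * a * (p * q) + b * (p * s + q * r) + (+ 2) * c * (r * s))
       (a * (q * q) + b * (q * s) + c * (s * s))

_∼_ : Form → Form → Set
f ∼ g = Σ ℤ λ p → Σ ℤ λ q → Σ ℤ λ r → Σ ℤ λ s →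
          (p * s - q * r ≡ + 1) × (act f p q r s ≡ g)

-- principal form of discriminant -4d : x^2 + d y^2 (identity of CL(-4d))
principal : ℤ → Form
principal d = form (+ 1) (+ 0) d

aP : ℤ → ℤ → ℤ → ℤ → ℤ
aP u v A C = A * v + C * C * u

gP : ℤ → ℤ → ℤ
gP C v = gcd C v

leadP : ℤ → ℤ → ℤ → ℤ → ℤ
leadP u v A C = divℤ (v * aP u v A C) (gP C v * gP C v)

Admissible : ℤ → ℤ → ℤ → ℤ → ℤ → Set
Admissible u v A C μ =
  leadP u v A C ∣ (divℤ (C * C * C) (gP C v * gP C v) * μ - + 1)

Φ : ℤ → ℤ → ℤ → ℤ → ℤ → ℤ → ℤ → ℤ → Form
Φ a4 a6 u v A B C μ =
  let g2 = gP C v * gP C v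
      α  = leadP u v A C
      β  = divℤ (B * (v * v)) g2
  in form α ((+ 2) * μ * β) (divℤ (μ * μ * (β * β) + dE a4 a6 u v) α)

-- Write g = gcd(C,v), C = cg and v = wg. The quantities defining Φ become
-- α = va/g² = w(Aw + gc²u), k = C³/g² = c³g and β = Bv²/g² = Bw², and the curve
-- equation B² = A³ + a₄AC⁴ + a₆C⁶ turns into the norm identity β² + k²d = Qα.
-- Then kμ ≡ 1 (mod α) gives μ²β² + d ≡ μ²(β² + k²d) ≡ 0 (mod α), so Φ(P,μ) is an
-- integral form, and two admissible μ differ by a multiple tα, so the two forms
-- differ by the shear x ↦ x + tβy. If Φ(P,μ) is principal, then α = s² + dr² is
-- represented by x² + dy²: either r = 0 and α = 1, which forces v ∣ C, or α ≥ d.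
module Submission where

open import Defs
open import Data.Integer
  using (ℤ; +_; -[1+_]; -_; _+_; _-_; _*_; _≤_; _<_; ∣_∣; _/_; _%_; NonZero; +≤+; nonNegative)
open import Data.Integer.Divisibility using (_∣_)
open import Data.Integer.Properties
open import Data.Integer.Tactic.RingSolver using (solve)
open import Data.Integer.DivMod using (a≡a%n+[a/n]*n; n%d<d)
import Data.Integer.Divisibility.Signed as S
open import Data.Integer.GCD using (gcd; gcd[i,j]∣i; gcd[i,j]∣j; gcd[i,j]≡0⇒i≡0)
import Data.Nat as ℕ
import Data.Nat.Properties as ℕ
open import Data.Empty using (⊥-elim)
open import Data.List using (_∷_; [])
open import Data.Product using (_×_; _,_)
open import Data.Sum using (_⊎_; inj₁; inj₂; [_,_]′; map₁)
open import Function using (id; _∘_)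
open import Relation.Binary.PropositionalEquality
open import Relation.Nullary using (Dec; yes; no)

i*j/j≡i : ∀ i j .{{_ : NonZero j}} → i * j / j ≡ i
i*j/j≡i i j = sym (i-j≡0⇒i≡j i q (∣i∣≡0⇒i≡0 (ℕ.n<1⇒n≡0 ∣i-q∣<1)))
  where
  q : ℤ
  q = i * j / j
  r : ℕ.ℕ
  r = i * j % j
  cancel-quotient : ∀ a b m n → a * m ≡ n + b * m → (a - b) * m ≡ n
  cancel-quotient a b m n eq = begin
    (a - b) * m       ≡⟨ solve (a ∷ b ∷ m ∷ []) ⟩
    a * m - b * m     ≡⟨ cong (_- b * m) eq ⟩
    n + b * m - b * m ≡⟨ solve (n ∷ b ∷ m ∷ []) ⟩
    n                 ∎
    where open ≡-Reasoning
  ∣i-q∣<1 : ∣ i - q ∣ ℕ.< 1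
  ∣i-q∣<1 = ℕ.*-cancelʳ-< ∣ j ∣ ∣ i - q ∣ 1 (begin-strict
    ∣ i - q ∣ ℕ.* ∣ j ∣ ≡⟨ abs-* (i - q) j ⟨
    ∣ (i - q) * j ∣     ≡⟨ cong ∣_∣ (cancel-quotient i q j (+ r) (a≡a%n+[a/n]*n (i * j) j)) ⟩
    r                   <⟨ n%d<d (i * j) j ⟩
    ∣ j ∣               ≡⟨ ℕ.*-identityˡ ∣ j ∣ ⟨
    1 ℕ.* ∣ j ∣         ∎)
    where open ℕ.≤-Reasoning

divℤ-exact : ∀ {n m x} → m ≢ + 0 → n ≡ x * m → divℤ n m ≡ x
divℤ-exact {m = + 0}       m≢0 _    = ⊥-elim (m≢0 refl)
divℤ-exact {m = + ℕ.suc k} _   refl = i*j/j≡i _ (+ ℕ.suc k)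
divℤ-exact {m = -[1+ k ]}  _   refl = i*j/j≡i _ -[1+ k ]

i≢0⇒i*i≢0 : ∀ {i} → i ≢ + 0 → i * i ≢ + 0
i≢0⇒i*i≢0 {i} i≢0 = i≢0 ∘ [ id , id ]′ ∘ i*j≡0⇒i≡0∨j≡0 i

0≤i*i : ∀ i → + 0 ≤ i * i
0≤i*i (+ 0)       = +≤+ ℕ.z≤n
0≤i*i (+ ℕ.suc n) = +≤+ ℕ.z≤n
0≤i*i -[1+ n ]    = +≤+ ℕ.z≤n

i≢0⇒1≤i*i : ∀ {i} → i ≢ + 0 → + 1 ≤ i * i
i≢0⇒1≤i*i {+ 0}       i≢0 = ⊥-elim (i≢0 refl)
i≢0⇒1≤i*i {+ ℕ.suc n} _   = +≤+ (ℕ.s≤s ℕ.z≤n)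
i≢0⇒1≤i*i { -[1+ n ]} _   = +≤+ (ℕ.s≤s ℕ.z≤n)

i*j≡1⇒j*j≡1 : ∀ i j → i * j ≡ + 1 → j * j ≡ + 1
i*j≡1⇒j*j≡1 i j eq with ℕ.m*n≡1⇒n≡1 ∣ i ∣ ∣ j ∣ (trans (sym (abs-* i j)) (cong ∣_∣ eq))
i*j≡1⇒j*j≡1 i (+ 1)    eq | refl = refl
i*j≡1⇒j*j≡1 i -[1+ 0 ] eq | refl = refl

d≤x²+dy² : ∀ {d} x {y} → + 0 ≤ d → y ≢ + 0 → d ≤ x * x + d * (y * y)
d≤x²+dy² {d} x {y} 0≤d y≢0 = begin
  d             ≡⟨ *-identityʳ d ⟨
  d * + 1       ≤⟨ *-monoˡ-≤-nonNeg d {{nonNegative 0≤d}} (i≢0⇒1≤i*i y≢0) ⟩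
  d * (y * y)   ≤⟨ i≤j+i _ (x * x) {{nonNegative (0≤i*i x)}} ⟩
  x * x + d * (y * y) ∎
  where open ≤-Reasoning

form-cong : ∀ {a b c a′ b′ c′} → a ≡ a′ → b ≡ b′ → c ≡ c′ → form a b c ≡ form a′ b′ c′
form-cong refl refl refl = refl

act-identity : ∀ f → act f (+ 1) (+ 0) (+ 0) (+ 1) ≡ f
act-identity (form a b c) = form-cong
  (solve (a ∷ b ∷ c ∷ []))
  (solve (a ∷ b ∷ c ∷ []))
  (solve (a ∷ b ∷ c ∷ []))

∼-refl : ∀ {f} → f ∼ f
∼-refl {f} = + 1 , + 0 , + 0 , + 1 , refl , act-identity f

act-shear : ∀ a b c t → act (form a b c) (+ 1) t (+ 0) (+ 1) ≡ form a (b + (+ 2) * a * t) (a * (t * t) + b * t + c)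
act-shear a b c t = form-cong
  (solve (a ∷ b ∷ c ∷ t ∷ []))
  (solve (a ∷ b ∷ c ∷ t ∷ []))
  (solve (a ∷ b ∷ c ∷ t ∷ []))

act-inverse-fa : ∀ f p q r s →
  Form.fa (act (act f p q r s) s (- q) (- r) p) ≡ Form.fa f * ((p * s - q * r) * (p * s - q * r))
act-inverse-fa (form a b c) p q r s = begin
    (a * (p * p) + b * (p * r) + c * (r * r)) * (s * s)
  + ((+ 2) * a * (p * q) + b * (p * s + q * r) + (+ 2) * c * (r * s)) * (s * (- r))
  + (a * (q * q) + b * (q * s) + c * (s * s)) * ((- r) * (- r))
    ≡⟨ solve (a ∷ b ∷ c ∷ p ∷ q ∷ r ∷ s ∷ []) ⟩
  a * ((p * s - q * r) * (p * s - q * r)) ∎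
  where open ≡-Reasoning

act≡principal⇒fa≡s²+dr² : ∀ f {d} p q r s → p * s - q * r ≡ + 1 → act f p q r s ≡ principal d →
                          Form.fa f ≡ s * s + d * (r * r)
act≡principal⇒fa≡s²+dr² f {d} p q r s det≡1 f↦principal = begin
  Form.fa f                                       ≡⟨ *-identityʳ _ ⟨
  Form.fa f * (+ 1 * + 1)                         ≡⟨ cong (λ x → Form.fa f * (x * x)) det≡1 ⟨
  Form.fa f * ((p * s - q * r) * (p * s - q * r)) ≡⟨ act-inverse-fa f p q r s ⟨
  Form.fa (act (act f p q r s) s (- q) (- r) p)   ≡⟨ cong (λ h → Form.fa (act h s (- q) (- r) p)) f↦principal ⟩
  Form.fa (act (principal d) s (- q) (- r) p)     ≡⟨⟩
  + 1 * (s * s) + + 0 * (s * (- r)) + d * ((- r) * (- r)) ≡⟨ solve (d ∷ r ∷ s ∷ []) ⟩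
  s * s + d * (r * r)                             ∎
  where open ≡-Reasoning

∼principal⇒fa≡1⊎d≤fa : ∀ f {d} → + 0 < d → f ∼ principal d → Form.fa f ≡ + 1 ⊎ d ≤ Form.fa f
∼principal⇒fa≡1⊎d≤fa f {d} 0<d (p , q , r , s , det≡1 , f↦principal) with r ≟ + 0
... | yes refl = inj₁ (begin
  Form.fa f       ≡⟨ act≡principal⇒fa≡s²+dr² f p q (+ 0) s det≡1 f↦principal ⟩
  s * s + d * + 0 ≡⟨ cong₂ _+_ (i*j≡1⇒j*j≡1 p s ps≡1) (*-zeroʳ d) ⟩
  + 1             ∎)
  where
  open ≡-Reasoning
  ps≡1 : p * s ≡ + 1
  ps≡1 = begin
    p * s           ≡⟨ +-identityʳ (p * s) ⟨
    p * s - + 0     ≡⟨ cong (λ x → p * s - x) (*-zeroʳ q) ⟨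
    p * s - q * + 0 ≡⟨ det≡1 ⟩
    + 1             ∎
... | no r≢0 = inj₂ (subst (d ≤_) (sym (act≡principal⇒fa≡s²+dr² f p q r s det≡1 f↦principal))
                                  (d≤x²+dy² s (<⇒≤ 0<d) r≢0))

Φform : ℤ → ℤ → ℤ → ℤ → Form
Φform α β d μ = form α ((+ 2) * μ * β) (divℤ (μ * μ * (β * β) + d) α)

Φform-shear : ∀ {α} β d μ w t → α ≢ + 0 → μ * μ * (β * β) + d ≡ w * α →
              Φform α β d μ ∼ Φform α β d (μ + t * α)
Φform-shear {α} β d μ w t α≢0 num≡wα =
  + 1 , t * β , + 0 , + 1 , solve (t ∷ β ∷ []) , (begin
    act (Φform α β d μ) (+ 1) (t * β) (+ 0) (+ 1)
      ≡⟨ act-shear α ((+ 2) * μ * β) _ (t * β) ⟩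
    form α ((+ 2) * μ * β + (+ 2) * α * (t * β)) (α * (t * β * (t * β)) + (+ 2) * μ * β * (t * β) + c)
      ≡⟨ form-cong refl (solve (α ∷ β ∷ μ ∷ t ∷ []))
                   (cong (λ x → α * (t * β * (t * β)) + (+ 2) * μ * β * (t * β) + x) c≡w) ⟩
    form α ((+ 2) * (μ + t * α) * β) (α * (t * β * (t * β)) + (+ 2) * μ * β * (t * β) + w)
      ≡⟨ cong (form α _) (divℤ-exact α≢0 shifted-num≡) ⟨
    Φform α β d (μ + t * α) ∎)
  where
  open ≡-Reasoning
  c : ℤ
  c = divℤ (μ * μ * (β * β) + d) α
  c≡w : c ≡ w
  c≡w = divℤ-exact α≢0 num≡wα
  shifted-num≡ : (μ + t * α) * (μ + t * α) * (β * β) + d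
               ≡ (α * (t * β * (t * β)) + (+ 2) * μ * β * (t * β) + w) * α
  shifted-num≡ = begin
    (μ + t * α) * (μ + t * α) * (β * β) + d
      ≡⟨ solve (μ ∷ t ∷ α ∷ β ∷ d ∷ []) ⟩
    (μ * μ * (β * β) + d) + (α * (t * β * (t * β)) + (+ 2) * μ * β * (t * β)) * α
      ≡⟨ cong (_+ (α * (t * β * (t * β)) + (+ 2) * μ * β * (t * β)) * α) num≡wα ⟩
    w * α + (α * (t * β * (t * β)) + (+ 2) * μ * β * (t * β)) * α
      ≡⟨ solve (w ∷ α ∷ t ∷ β ∷ μ ∷ []) ⟩
    (α * (t * β * (t * β)) + (+ 2) * μ * β * (t * β) + w) * α ∎

Φform-shift : ∀ {α} β d μ μ′ → α S.∣ μ * μ * (β * β) + d → α S.∣ μ′ - μ →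
              Φform α β d μ ∼ Φform α β d μ′
Φform-shift {α} β d μ μ′ (S.divides w num≡wα) (S.divides t μ′-μ≡tα) =
  subst (λ m → Φform α β d μ ∼ Φform α β d m) (sym μ′≡μ+tα) (Φμ∼Φ[μ+tα] (α ≟ + 0))
  where
  open ≡-Reasoning
  μ′≡μ+tα : μ′ ≡ μ + t * α
  μ′≡μ+tα = begin
    μ′           ≡⟨ solve (μ′ ∷ μ ∷ []) ⟩
    μ + (μ′ - μ) ≡⟨ cong (λ x → μ + x) μ′-μ≡tα ⟩
    μ + t * α    ∎
  Φμ∼Φ[μ+tα] : Dec (α ≡ + 0) → Φform α β d μ ∼ Φform α β d (μ + t * α)
  Φμ∼Φ[μ+tα] (no α≢0)  = Φform-shear β d μ w t α≢0 num≡wα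
  Φμ∼Φ[μ+tα] (yes α≡0) = subst (λ m → Φform α β d μ ∼ Φform α β d m) μ≡μ+tα ∼-refl
    where
    μ≡μ+tα : μ ≡ μ + t * α
    μ≡μ+tα = begin
      μ           ≡⟨ +-identityʳ μ ⟨
      μ + + 0     ≡⟨ cong (λ x → μ + x) (*-zeroʳ t) ⟨
      μ + t * + 0 ≡⟨ cong (λ a → μ + t * a) α≡0 ⟨
      μ + t * α   ∎

kμ≡1-unique : ∀ {α} k μ μ′ → α S.∣ k * μ - + 1 → α S.∣ k * μ′ - + 1 → α S.∣ μ′ - μ
kμ≡1-unique {α} k μ μ′ kμ≡1 kμ′≡1 =
  subst (α S.∣_) difference (S.∣m∣n⇒∣m-n (S.∣n⇒∣m*n μ kμ′≡1) (S.∣n⇒∣m*n μ′ kμ≡1))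
  where
  difference : μ * (k * μ′ - + 1) - μ′ * (k * μ - + 1) ≡ μ′ - μ
  difference = solve (k ∷ μ ∷ μ′ ∷ [])

Φ-numerator-divisible : ∀ {α} β k d μ → α S.∣ β * β + k * k * d → α S.∣ k * μ - + 1 →
                        α S.∣ μ * μ * (β * β) + d
Φ-numerator-divisible {α} β k d μ norm kμ≡1 =
  subst (α S.∣_) numerator
        (S.∣m∣n⇒∣m-n (S.∣n⇒∣m*n (μ * μ) norm) (S.∣m⇒∣m*n (k * μ + + 1) (S.∣n⇒∣m*n d kμ≡1)))
  where
  numerator : μ * μ * (β * β + k * k * d) - d * (k * μ - + 1) * (k * μ + + 1) ≡ μ * μ * (β * β) + d
  numerator = solve (μ ∷ β ∷ k ∷ d ∷ [])

Φform-independent : ∀ {α} β k d μ μ′ → α S.∣ β * β + k * k * d →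
                    α S.∣ k * μ - + 1 → α S.∣ k * μ′ - + 1 → Φform α β d μ ∼ Φform α β d μ′
Φform-independent β k d μ μ′ norm kμ≡1 kμ′≡1 =
  Φform-shift β d μ μ′ (Φ-numerator-divisible β k d μ norm kμ≡1) (kμ≡1-unique k μ μ′ kμ≡1 kμ′≡1)

Weierstrass : ℤ → ℤ → ℤ → ℤ → ℤ → Set
Weierstrass a4 a6 A B C = B * B ≡ A * A * A + a4 * A * (C * C * C * C) + a6 * (C * C * C * C * C * C)

x≡y⇒p+w*[x-y]≡p : ∀ p w {x y} → x ≡ y → p + w * (x - y) ≡ p
x≡y⇒p+w*[x-y]≡p p w {x} refl = begin
  p + w * (x - x) ≡⟨ cong (λ z → p + w * z) (+-inverseʳ x) ⟩
  p + w * + 0     ≡⟨ cong (λ z → p + z) (*-zeroʳ w) ⟩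
  p + + 0         ≡⟨ +-identityʳ p ⟩
  p               ∎
  where open ≡-Reasoning

reduced-norm-divisible : ∀ a4 a6 u A B c w g → Weierstrass a4 a6 A B (c * g) →
  w * (A * w + g * (c * c) * u) S.∣
    B * (w * w) * (B * (w * w)) + c * c * c * g * (c * c * c * g) * dE a4 a6 u (w * g)
-- With X = Aw, Y = gc²u, Z = g²c², the curve equation turns the dividend into
-- w(X³ + Y³ + a4·w²Z²(X + Y)) = w(X + Y)(X² − XY + Y² + a4·w²Z²); the quotient is the last factor.
reduced-norm-divisible a4 a6 u A B c w g onCurve = S.divides
  (A * A * (w * w) - A * w * (g * (c * c) * u) + g * g * (c * c * c * c) * (u * u) + a4 * (w * w) * (g * g * g * g * (c * c * c * c)))
  (begin
    B * (w * w) * (B * (w * w))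
      + c * c * c * g * (c * c * c * g) * (w * g * (u * u * u + a4 * u * (w * g * (w * g)) - a6 * (w * g * (w * g) * (w * g))))
  ≡⟨ solve (a4 ∷ a6 ∷ u ∷ A ∷ B ∷ c ∷ g ∷ w ∷ []) ⟩
    (A * A * (w * w) - A * w * (g * (c * c) * u) + g * g * (c * c * c * c) * (u * u) + a4 * (w * w) * (g * g * g * g * (c * c * c * c)))
      * (w * (A * w + g * (c * c) * u))
      + w * w * w * w * (B * B - (A * A * A + a4 * A * (c * g * (c * g) * (c * g) * (c * g))
                                   + a6 * (c * g * (c * g) * (c * g) * (c * g) * (c * g) * (c * g))))
  ≡⟨ x≡y⇒p+w*[x-y]≡p _ (w * w * w * w) onCurve ⟩
    (A * A * (w * w) - A * w * (g * (c * c) * u) + g * g * (c * c * c * c) * (u * u) + a4 * (w * w) * (g * g * g * g * (c * c * c * c)))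
      * (w * (A * w + g * (c * c) * u)) ∎)
  where open ≡-Reasoning

lead≡w[Aw+gc²u] : ∀ u A c w g {v C} → g ≢ + 0 → C ≡ c * g → v ≡ w * g →
                  divℤ (v * aP u v A C) (g * g) ≡ w * (A * w + g * (c * c) * u)
lead≡w[Aw+gc²u] u A c w g g≢0 refl refl = divℤ-exact (i≢0⇒i*i≢0 g≢0) (begin
  w * g * (A * (w * g) + c * g * (c * g) * u) ≡⟨ solve (u ∷ A ∷ c ∷ w ∷ g ∷ []) ⟩
  w * (A * w + g * (c * c) * u) * (g * g)     ∎)
  where open ≡-Reasoning

norm-divisible : ∀ a4 a6 u A B c w g {v C} → g ≢ + 0 → C ≡ c * g → v ≡ w * g →
  Weierstrass a4 a6 A B C →
  divℤ (v * aP u v A C) (g * g) S.∣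
    divℤ (B * (v * v)) (g * g) * divℤ (B * (v * v)) (g * g)
      + divℤ (C * C * C) (g * g) * divℤ (C * C * C) (g * g) * dE a4 a6 u v
norm-divisible a4 a6 u A B c w g g≢0 refl refl onCurve =
  subst₂ S._∣_ (sym (lead≡w[Aw+gc²u] u A c w g g≢0 refl refl))
               (sym (cong₂ (λ β k → β * β + k * k * dE a4 a6 u (w * g)) β≡Bw² k≡c³g))
               (reduced-norm-divisible a4 a6 u A B c w g onCurve)
  where
  open ≡-Reasoning
  k≡c³g : divℤ (c * g * (c * g) * (c * g)) (g * g) ≡ c * c * c * g
  k≡c³g = divℤ-exact (i≢0⇒i*i≢0 g≢0) (begin
    c * g * (c * g) * (c * g) ≡⟨ solve (c ∷ g ∷ []) ⟩
    c * c * c * g * (g * g)   ∎)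
  β≡Bw² : divℤ (B * (w * g * (w * g))) (g * g) ≡ B * (w * w)
  β≡Bw² = divℤ-exact (i≢0⇒i*i≢0 g≢0) (begin
    B * (w * g * (w * g)) ≡⟨ solve (B ∷ w ∷ g ∷ []) ⟩
    B * (w * w) * (g * g) ∎)

lead≡1⇒v∣C : ∀ u A c w g {v C} → g ≢ + 0 → C ≡ c * g → v ≡ w * g →
             divℤ (v * aP u v A C) (g * g) ≡ + 1 → v ∣ C
lead≡1⇒v∣C u A c w g g≢0 refl refl lead≡1 =
  S.∣⇒∣ᵤ (S.divides (c * (A * w + g * (c * c) * u)) (begin
    c * g                                 ≡⟨ *-identityʳ (c * g) ⟨
    c * g * + 1                           ≡⟨ cong (λ x → c * g * x) wa≡1 ⟨
    c * g * (w * (A * w + g * (c * c) * u)) ≡⟨ solve (u ∷ A ∷ c ∷ w ∷ g ∷ []) ⟩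
    c * (A * w + g * (c * c) * u) * (w * g) ∎))
  where
  open ≡-Reasoning
  wa≡1 : w * (A * w + g * (c * c) * u) ≡ + 1
  wa≡1 = trans (sym (lead≡w[Aw+gc²u] u A c w g g≢0 refl refl)) lead≡1

theorem2p3 : (a4 a6 u v : ℤ) → IsElliptic a4 a6 → MapSuitable a4 a6 u v
    → FundamentalDisc (- DE a4 a6 u v)
    → (A B C : ℤ) → PointRep a4 a6 A B C
    → ((μ μ′ : ℤ) → Admissible u v A C μ → Admissible u v A C μ′
    → Φ a4 a6 u v A B C μ ∼ Φ a4 a6 u v A B C μ′)
    × ((μ : ℤ) → Admissible u v A C μ
    → Φ a4 a6 u v A B C μ ∼ principal (dE a4 a6 u v)
    → v ∣ C ⊎ dE a4 a6 u v ≤ leadP u v A C)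
theorem2p3 a4 a6 u v _ (_ , _ , _ , 0<DE) _ A B C (0<C , _ , _ , onCurve) =
    (λ μ μ′ adm adm′ → Φform-independent β k d μ μ′ norm (S.∣ᵤ⇒∣ adm) (S.∣ᵤ⇒∣ adm′))
  , (λ μ _ Φ∼principal → map₁ (lead≡1⇒v∣C u A c w g g≢0 C≡cg v≡wg)
                              (∼principal⇒fa≡1⊎d≤fa (Φ a4 a6 u v A B C μ) 0<d Φ∼principal))
  where
  g β k d : ℤ
  g = gcd C v
  β = divℤ (B * (v * v)) (g * g)
  k = divℤ (C * C * C) (g * g)
  d = dE a4 a6 u v
  g∣C : g S.∣ C
  g∣C = S.∣ᵤ⇒∣ (gcd[i,j]∣i C v)
  g∣v : g S.∣ v
  g∣v = S.∣ᵤ⇒∣ (gcd[i,j]∣j C v)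
  open S._∣_ g∣C renaming (quotient to c; equality to C≡cg)
  open S._∣_ g∣v renaming (quotient to w; equality to v≡wg)
  g≢0 : g ≢ + 0
  g≢0 = <⇒≢ 0<C ∘ sym ∘ gcd[i,j]≡0⇒i≡0 C v
  0<d : + 0 < d
  0<d = *-cancelˡ-<-nonNeg (+ 4) 0<DE
  norm : leadP u v A C S.∣ β * β + k * k * d
  norm = norm-divisible a4 a6 u A B c w g g≢0 C≡cg v≡wg onCurve
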